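{- If $G=G[X,Y]$ is a $c$-almost-complete bipartite graph with parts $X,Y$, then for every even integer $m$ with $4c+2\le m\le 2\min\{|X|,|Y|\}$, $G$ contains a cycle on $m$ vertices.
   Context: A bipartite graph $G[X,Y]$ is $c$-almost-complete if every $x\in X$ has degree at least $|Y|-c$ and every $y\in Y$ has degree at least $|X|-c$. -}

module Defs where

open import Data.Nat using (ℕ; suc; _∸_; _≤_)
open import Data.Bool using (Bool; true; T)
open import Data.Fin using (Fin; zero; suc; inject₁; fromℕ)
open import Data.List using (length; filter; allFin)
open import Data.Product using (Σ; _×_; _,_)
open import Relation.Nullary.Decidable using (T?)
open import Function.Definitions using (Injective)
open import Relation.Binary.PropositionalEquality using (_≡_)

BipGraph : ℕ → ℕ → Set
BipGraph a b = Fin a → Fin b → Bool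

degX : ∀ {a b} → BipGraph a b → Fin a → ℕ
degX {a} {b} G x = length (filter (λ y → T? (G x y)) (allFin b))

degY : ∀ {a b} → BipGraph a b → Fin b → ℕ
degY {a} {b} G y = length (filter (λ x → T? (G x y)) (allFin a))

AlmostComplete : ∀ {a b} → ℕ → BipGraph a b → Set
AlmostComplete {a} {b} c G =
  (∀ x → b ∸ c ≤ degX G x) × (∀ y → a ∸ c ≤ degY G y)

-- A cycle on 2k vertices (k = suc n) in a bipartite graph:
-- distinct x₀,…,x_n ∈ X and distinct y₀,…,y_n ∈ Y with the closed walk
-- x₀ y₀ x₁ y₁ … x_n y_n x₀, i.e. edges x_i y_i, y_j x_{j+1}, y_n x₀.
record BipCycle {a b : ℕ} (G : BipGraph a b) (n : ℕ) : Set where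
  field
    xs     : Fin (suc n) → Fin a
    ys     : Fin (suc n) → Fin b
    xs-inj : Injective _≡_ _≡_ xs
    ys-inj : Injective _≡_ _≡_ ys
    edge₁  : ∀ i → T (G (xs i) (ys i))
    edge₂  : ∀ (j : Fin n) → T (G (xs (suc j)) (ys (inject₁ j)))
    close  : T (G (xs zero) (ys (fromℕ n)))

-- G contains a cycle on m vertices (m = 2k, k ≥ 2 so that it is a genuine cycle)
HasCycleOn : ∀ {a b} → BipGraph a b → ℕ → Set
HasCycleOn G m = Σ ℕ λ n → (m ≡ 2 Data.Nat.* suc n) × (1 ≤ n) × BipCycle G n

-- Pósa's rotation argument. Grow a path x₀ y₀ x₁ y₁ … xₗ yₗ one pair (x , y) at a time,
-- taking yₗ ∼ x ∼ y with x, y off the path while possible. If all neighbours of yₗ lie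
-- on the path, yₗ misses at most (l + 1) − (|X| − c) of its vertices in X and x₀ at most
-- c of those in Y; as 2c < |X| that is fewer than l + 1 in total, so by pigeonhole some
-- pair has xⱼ ∼ yₗ and x₀ ∼ yⱼ, and reversing x₀ … xⱼ closes the path into a cycle on
-- the same vertices. If yₗ has an outside neighbour x all of whose neighbours lie on the
-- path, reverse the path to start at x and close it the same way. A cycle shorter than
-- k ≤ min(|X|, |Y|) leaves vertices x, y off it, and counting once more opens it into a
-- longer path, through the edge xy or through x and y separately. Finally a path with k
-- pairs closes into the required cycle because 2c < k.

module Submission where

open import Defs
open import Data.Bool using (T)
open import Data.Empty using (⊥-elim)
open import Data.Fin using (Fin; zero; suc; fromℕ; fromℕ<; inject₁) renaming (_≟_ to _≟ᶠ_)
open import Data.Fin.Properties using (any?; ¬∀⟶∃¬)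
open import Data.List using (List; []; _∷_; _++_; [_]; length; filter; map; foldl; allFin; lookup)
open import Data.List.Properties using (length-++-sucʳ; length-tabulate; length-map; foldl-++; map-++; ++-assoc)
import Data.List.Membership.DecPropositional as DecMembership
open import Data.List.Membership.Propositional using (_∈_; _∉_)
open import Data.List.Membership.Propositional.Properties
  using (∈-∃++; ∈-++⁻; ∈-++⁺ˡ; ∈-++⁺ʳ; ∈-filter⁻; ∈-filter⁺; ∈-allFin; ∈-map⁺; ∈-lookup)
open import Data.List.Relation.Binary.Permutation.Propositional
  using (_↭_; ↭-refl; ↭-sym; prep; swap; ↭⇒↭ₛ; module PermutationReasoning)
open import Data.List.Relation.Binary.Permutation.Propositional.Properties
  using (++-comm; shift; ∷↭∷ʳ; ++⁺ʳ; map⁺; ↭-length; ∈-resp-↭)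
import Data.List.Relation.Binary.Permutation.Setoid.Properties as PermutationSetoid
open import Data.List.Relation.Binary.Subset.Propositional using (_⊆_)
open import Data.List.Relation.Unary.All as All using ([])
open import Data.List.Relation.Unary.All.Properties.Core using (¬Any⇒All¬)
open import Data.List.Relation.Unary.AllPairs using ([]; _∷_)
open import Data.List.Relation.Unary.Any using (Any; here; there; satisfied)
import Data.List.Relation.Unary.Any.Properties as Any
open import Data.List.Relation.Unary.Unique.Propositional using (Unique)
import Data.List.Relation.Unary.Unique.Propositional.Properties as Unique
open import Data.Nat using (ℕ; zero; suc; _+_; _*_; _∸_; _⊓_; _≤_; _<_; z≤n; s≤s; s≤s⁻¹)
open import Data.Nat.Properties
open import Algebra.Properties.CommutativeSemigroup +-commutativeSemigroup using (xy∙z≈xz∙y; interchange)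
open import Data.Nat.Tactic.RingSolver using (solve-∀)
open import Data.Product using (∃; _×_; _,_; proj₁; proj₂)
open import Data.Sum using (_⊎_; inj₁; inj₂)
open import Data.Unit using (⊤; tt)
open import Function using (_∘_; id)
open import Relation.Nullary using (Dec; yes; no)
open import Relation.Nullary.Decidable using (T?; ¬?; _×-dec_; decidable-stable)
open import Relation.Unary using (Decidable)
open import Relation.Unary.Properties using (∁?)
open import Relation.Binary.PropositionalEquality using (_≡_; refl; sym; trans; cong; subst; setoid)

-- Counting in lists

count : {A : Set} {P : A → Set} → Decidable P → List A → ℕ
count P? xs = length (filter P? xs)

module _ {A : Set} where

  Unique-⊆⇒length≤ : {xs ys : List A} → Unique xs → xs ⊆ ys → length xs ≤ length ys
  Unique-⊆⇒length≤ {[]} _ _ = z≤n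
  Unique-⊆⇒length≤ {x ∷ xs} {ys} (x∉xs ∷ xs!) xs⊆ys with ∈-∃++ (xs⊆ys (here refl))
  ... | us , vs , refl = subst (_ ≤_) (sym (length-++-sucʳ us x vs))
                           (s≤s (Unique-⊆⇒length≤ xs! xs⊆us++vs))
    where
    xs⊆us++vs : xs ⊆ us ++ vs
    xs⊆us++vs z∈xs with ∈-++⁻ us (xs⊆ys (there z∈xs))
    ... | inj₁ z∈us = ∈-++⁺ˡ z∈us
    ... | inj₂ (here refl) = ⊥-elim (All.lookup x∉xs z∈xs refl)
    ... | inj₂ (there z∈vs) = ∈-++⁺ʳ us z∈vs

  module _ {P : A → Set} (P? : Decidable P) where

    count+count-∁≡length : ∀ xs → count P? xs + count (∁? P?) xs ≡ length xs
    count+count-∁≡length [] = refl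
    count+count-∁≡length (x ∷ xs) with P? x
    ... | yes _ = cong suc (count+count-∁≡length xs)
    ... | no _ = trans (+-suc _ _) (cong suc (count+count-∁≡length xs))

    count-∁<length⇒Any : ∀ xs → count (∁? P?) xs < length xs → Any P xs
    count-∁<length⇒Any (x ∷ xs) lt with P? x
    ... | yes px = here px
    ... | no _ = there (count-∁<length⇒Any xs (s≤s⁻¹ lt))

module _ {A B : Set} {P : A → Set} {Q : B → Set} (P? : Decidable P) (Q? : Decidable Q) where

  count-∁-+-count-∁<length⇒Any : ∀ (ps : List (A × B)) →
    count (∁? P?) (map proj₁ ps) + count (∁? Q?) (map proj₂ ps) < length ps →
    Any (λ p → P (proj₁ p) × Q (proj₂ p)) ps
  count-∁-+-count-∁<length⇒Any ((x , y) ∷ ps) lt with P? x | Q? y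
  ... | yes px | yes qy = here (px , qy)
  ... | yes _ | no _ = there (count-∁-+-count-∁<length⇒Any ps
                        (s≤s⁻¹ (subst (_< suc (length ps)) (+-suc _ _) lt)))
  ... | no _ | yes _ = there (count-∁-+-count-∁<length⇒Any ps (s≤s⁻¹ lt))
  ... | no _ | no _ = there (count-∁-+-count-∁<length⇒Any ps
                        (≤-<-trans (+-monoʳ-≤ _ (n≤1+n _)) (s≤s⁻¹ lt)))

_∈?_ : ∀ {n} (y : Fin n) (xs : List (Fin n)) → Dec (y ∈ xs)
_∈?_ = DecMembership._∈?_ _≟ᶠ_

∃∉ : ∀ {n} (xs : List (Fin n)) → length xs < n → ∃ λ y → y ∉ xs
∃∉ {n} xs xs<n = ¬∀⟶∃¬ n (_∈ xs) (_∈? xs) λ all∈xs →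
  <⇒≱ xs<n (subst (_≤ length xs) (length-tabulate id)
             (Unique-⊆⇒length≤ (Unique.allFin⁺ n) (λ {y} _ → all∈xs y)))

module _ {n : ℕ} {P : Fin n → Set} (P? : Decidable P) where

  ∃∉-or-⊆ : ∀ xs → (∃ λ y → y ∉ xs × P y) ⊎ (∀ y → P y → y ∈ xs)
  ∃∉-or-⊆ xs with any? (λ y → ¬? (y ∈? xs) ×-dec P? y)
  ... | yes witness = inj₁ witness
  ... | no none = inj₂ λ y py → decidable-stable (y ∈? xs) λ y∉xs → none (y , y∉xs , py)

  count-∁-Unique≤ : ∀ {xs} → Unique xs → count (∁? P?) xs ≤ count (∁? P?) (allFin n)
  count-∁-Unique≤ {xs} xs! = Unique-⊆⇒length≤ (Unique.filter⁺ (∁? P?) xs!)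
    λ z∈ → ∈-filter⁺ (∁? P?) (∈-allFin _) (proj₂ (∈-filter⁻ (∁? P?) {xs = xs} z∈))

  ⊆⇒count-∁+n≤ : ∀ xs → (∀ y → P y → y ∈ xs) →
                 count (∁? P?) xs + n ≤ length xs + count (∁? P?) (allFin n)
  ⊆⇒count-∁+n≤ xs P⊆xs = begin
    c∁ xs + n                  ≡⟨ cong (c∁ xs +_) (trans (count+count-∁≡length P? all) (length-tabulate id)) ⟨
    c∁ xs + (cP all + c∁ all)  ≡⟨ +-assoc (c∁ xs) (cP all) (c∁ all) ⟨
    c∁ xs + cP all + c∁ all    ≤⟨ +-monoˡ-≤ (c∁ all) (+-monoʳ-≤ (c∁ xs) cP-all≤cP-xs) ⟩
    c∁ xs + cP xs + c∁ all     ≡⟨ cong (_+ c∁ all) (trans (+-comm (c∁ xs) _) (count+count-∁≡length P? xs)) ⟩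
    length xs + c∁ all         ∎
    where
    open ≤-Reasoning
    c∁ = count (∁? P?)
    cP = count P?
    all = allFin n
    cP-all≤cP-xs : cP all ≤ cP xs
    cP-all≤cP-xs = Unique-⊆⇒length≤ (Unique.filter⁺ P? (Unique.allFin⁺ n)) λ z∈ →
      let pz = proj₂ (∈-filter⁻ P? {xs = all} z∈) in ∈-filter⁺ P? (P⊆xs _ pz) pz

Any-∃++ : ∀ {A : Set} {P : A → Set} {xs} → Any P xs →
          ∃ λ us → ∃ λ x → ∃ λ vs → xs ≡ us ++ x ∷ vs × P x
Any-∃++ (here px) = [] , _ , _ , refl , px
Any-∃++ (there pxs) with Any-∃++ pxs
... | us , x , vs , refl , px = _ ∷ us , x , vs , refl , px

Unique-resp-↭ : ∀ {A : Set} {xs ys : List A} → xs ↭ ys → Unique xs → Unique ys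
Unique-resp-↭ {A} xs↭ys = PermutationSetoid.Unique-resp-↭ (setoid A) (↭⇒↭ₛ xs↭ys)

length-map-↭ : ∀ {A B : Set} (f : A → B) {xs ys} → map f xs ↭ map f ys → length xs ≡ length ys
length-map-↭ f {xs} {ys} p = trans (sym (length-map f xs)) (trans (↭-length p) (length-map f ys))

map-lookup-injective : ∀ {A B : Set} (f : A → B) {xs} → Unique (map f xs) →
                       ∀ {i j} → f (lookup xs i) ≡ f (lookup xs j) → i ≡ j
map-lookup-injective f {_ ∷ _} _ {zero} {zero} _ = refl
map-lookup-injective f {_ ∷ _} (fx∉ ∷ _) {zero} {suc j} eq = ⊥-elim (All.lookup fx∉ (∈-map⁺ f (∈-lookup j)) eq)
map-lookup-injective f {_ ∷ _} (fx∉ ∷ _) {suc i} {zero} eq =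
  ⊥-elim (All.lookup fx∉ (∈-map⁺ f (∈-lookup i)) (sym eq))
map-lookup-injective f {_ ∷ _} (_ ∷ fxs!) {suc i} {suc j} eq = cong suc (map-lookup-injective f fxs! eq)

-- Non-neighbours in almost complete graphs

_ᵀ : ∀ {a b} → BipGraph a b → BipGraph b a
(G ᵀ) y x = G x y

misses : ∀ {a b} → BipGraph a b → Fin a → List (Fin b) → ℕ
misses G x = count (∁? (T? ∘ G x))

AlmostComplete-ᵀ : ∀ {a b c} {G : BipGraph a b} → AlmostComplete c G → AlmostComplete c (G ᵀ)
AlmostComplete-ᵀ (degX≥ , degY≥) = degY≥ , degX≥

module _ {a b c} {G : BipGraph a b} (ac : AlmostComplete c G) where

  misses-allFin≤ : ∀ x → misses G x (allFin b) ≤ c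
  misses-allFin≤ x = +-cancelˡ-≤ (degX G x) _ c (begin
    degX G x + misses G x (allFin b) ≡⟨ trans (count+count-∁≡length (T? ∘ G x) (allFin b)) (length-tabulate id) ⟩
    b                               ≤⟨ m≤n+m∸n b c ⟩
    c + (b ∸ c)                     ≤⟨ +-monoʳ-≤ c (proj₁ ac x) ⟩
    c + degX G x                    ≡⟨ +-comm c _ ⟩
    degX G x + c                    ∎)
    where open ≤-Reasoning

  misses-Unique≤ : ∀ x {ys} → Unique ys → misses G x ys ≤ c
  misses-Unique≤ x ys! = ≤-trans (count-∁-Unique≤ (T? ∘ G x) ys!) (misses-allFin≤ x)

  misses-⊇-neighbours : ∀ x ys → (∀ y → T (G x y) → y ∈ ys) → misses G x ys + b ≤ length ys + c
  misses-⊇-neighbours x ys N⊆ys =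
    ≤-trans (⊆⇒count-∁+n≤ (T? ∘ G x) ys N⊆ys) (+-monoʳ-≤ (length ys) (misses-allFin≤ x))

-- Paths and cycles as lists of pairs

module Walks {a b : ℕ} (G : BipGraph a b) where

  private variable
    x x₀ : Fin a
    y y₀ : Fin b
    p : Fin a × Fin b
    ps qs cs : List (Fin a × Fin b)

  Edge : Fin a → Fin b → Set
  Edge x y = T (G x y)

  -- Walk y [ (x₁ , y₁) , … , (xₙ , yₙ) ] : y x₁ y₁ … xₙ yₙ is a walk in G.
  Walk : Fin b → List (Fin a × Fin b) → Set
  Walk y [] = ⊤
  Walk y ((x , y′) ∷ ps) = Edge x y × Edge x y′ × Walk y′ ps

  end : Fin b → List (Fin a × Fin b) → Fin b
  end = foldl (λ _ → proj₂)

  Chain : List (Fin a × Fin b) → Set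
  Chain [] = ⊤
  Chain ((x , y) ∷ ps) = Edge x y × Walk y ps

  Closed : Fin b → List (Fin a × Fin b) → Set
  Closed y ps = Walk y ps × end y ps ≡ y

  Xs : List (Fin a × Fin b) → List (Fin a)
  Xs = map proj₁

  Ys : List (Fin a × Fin b) → List (Fin b)
  Ys = map proj₂

  Distinct : List (Fin a × Fin b) → Set
  Distinct ps = Unique (Xs ps) × Unique (Ys ps)

  Path : List (Fin a × Fin b) → Set
  Path ps = Chain ps × Distinct ps

  Cycle : List (Fin a × Fin b) → Set
  Cycle ps = (∃ λ y → Closed y ps) × Distinct ps

  endMisses : Fin a → Fin b → List (Fin a × Fin b) → ℕ
  endMisses x₀ y₀ ps =
    misses (G ᵀ) (end y₀ ps) (Xs ((x₀ , y₀) ∷ ps)) + misses G x₀ (Ys ((x₀ , y₀) ∷ ps))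

  HasPath : ℕ → Set
  HasPath n = ∃ λ ps → Path ps × length ps ≡ n

  HasCycle : ℕ → Set
  HasCycle n = ∃ λ ps → Cycle ps × length ps ≡ n

  Walk⇒Chain : Walk y ps → Chain ps
  Walk⇒Chain {ps = []} _ = tt
  Walk⇒Chain {ps = _ ∷ _} (_ , xy , w) = xy , w

  end-++ : ∀ y ps qs → end y (ps ++ qs) ≡ end (end y ps) qs
  end-++ = foldl-++ (λ _ → proj₂)

  Walk-++⁺ : ∀ ps → Walk y ps → Walk (end y ps) qs → Walk y (ps ++ qs)
  Walk-++⁺ [] _ w = w
  Walk-++⁺ (_ ∷ ps) (e , e′ , w) w′ = e , e′ , Walk-++⁺ ps w w′

  Walk-++⁻ : ∀ ps → Walk y (ps ++ qs) → Walk y ps × Walk (end y ps) qs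
  Walk-++⁻ [] w = tt , w
  Walk-++⁻ (_ ∷ ps) (e , e′ , w) = let wps , wqs = Walk-++⁻ ps w in (e , e′ , wps) , wqs

  Closed-rotate : ∀ ps → Closed y (ps ++ qs) → Closed (end y ps) (qs ++ ps)
  Closed-rotate {y} {qs} ps (w , returns) with Walk-++⁻ ps w
  ... | wps , wqs =
    Walk-++⁺ qs wqs (subst (λ z → Walk z ps) (sym qs-returns) wps) ,
    trans (end-++ _ qs ps) (cong (λ z → end z ps) qs-returns)
    where
    qs-returns : end (end y ps) qs ≡ y
    qs-returns = trans (sym (end-++ y ps qs)) returns

  -- The walk y x₁ y₁ … xₙ yₙ read backwards: yₙ xₙ yₙ₋₁ … y₁ x₁ y.
  reverseWalk : Fin b → List (Fin a × Fin b) → List (Fin a × Fin b)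
  reverseWalk y [] = []
  reverseWalk y ((x , y′) ∷ ps) = reverseWalk y′ ps ++ [ (x , y) ]

  end-reverseWalk : ∀ y ps → end (end y ps) (reverseWalk y ps) ≡ y
  end-reverseWalk y [] = refl
  end-reverseWalk y ((x , y′) ∷ ps) = end-++ _ (reverseWalk y′ ps) [ (x , y) ]

  Walk-reverse : ∀ ps → Walk y ps → Walk (end y ps) (reverseWalk y ps)
  Walk-reverse [] _ = tt
  Walk-reverse {y} ((x , y′) ∷ ps) (xy , xy′ , w) =
    Walk-++⁺ (reverseWalk y′ ps) (Walk-reverse ps w)
      (subst (λ z → Walk z [ (x , y) ]) (sym (end-reverseWalk y′ ps)) (xy′ , xy , tt))

  Xs-reverseWalk : ∀ y ps → Xs (reverseWalk y ps) ↭ Xs ps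
  Xs-reverseWalk y [] = ↭-refl
  Xs-reverseWalk y ((x , y′) ∷ ps) = begin
    Xs (reverseWalk y′ ps ++ [ (x , y) ]) ≡⟨ map-++ proj₁ (reverseWalk y′ ps) _ ⟩
    Xs (reverseWalk y′ ps) ++ [ x ]        ↭⟨ ↭-sym (∷↭∷ʳ x _) ⟩
    x ∷ Xs (reverseWalk y′ ps)             <⟨ Xs-reverseWalk y′ ps ⟩
    x ∷ Xs ps                              ∎
    where open PermutationReasoning

  Ys-reverseWalk : ∀ y ps → end y ps ∷ Ys (reverseWalk y ps) ↭ y ∷ Ys ps
  Ys-reverseWalk y [] = ↭-refl
  Ys-reverseWalk y ((x , y′) ∷ ps) = begin
    end y′ ps ∷ Ys (reverseWalk y′ ps ++ [ (x , y) ]) ≡⟨ cong (_ ∷_) (map-++ proj₂ (reverseWalk y′ ps) _) ⟩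
    (end y′ ps ∷ Ys (reverseWalk y′ ps)) ++ [ y ]   ↭⟨ ↭-sym (∷↭∷ʳ y _) ⟩
    y ∷ end y′ ps ∷ Ys (reverseWalk y′ ps)          ↭⟨ prep y (Ys-reverseWalk y′ ps) ⟩
    y ∷ y′ ∷ Ys ps                                  ∎
    where open PermutationReasoning

  Distinct-↭ : Xs ps ↭ Xs qs → Ys ps ↭ Ys qs → Distinct ps → Distinct qs
  Distinct-↭ pX pY (xs! , ys!) = Unique-resp-↭ pX xs! , Unique-resp-↭ pY ys!

  Distinct-∷ : x ∉ Xs ps → y ∉ Ys ps → Distinct ps → Distinct ((x , y) ∷ ps)
  Distinct-∷ x∉ y∉ (xs! , ys!) = ¬Any⇒All¬ _ x∉ ∷ xs! , ¬Any⇒All¬ _ y∉ ∷ ys!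

  Path-snoc : Path ((x₀ , y₀) ∷ ps) → x ∉ Xs ((x₀ , y₀) ∷ ps) → y ∉ Ys ((x₀ , y₀) ∷ ps) →
              Edge x (end y₀ ps) → Edge x y → HasPath (2 + length ps)
  Path-snoc {x₀} {y₀} {ps} {x} {y} ((x₀y₀ , w) , d) x∉ y∉ xyₗ xy =
    P ++ [ (x , y) ] ,
    ((x₀y₀ , Walk-++⁺ ps w (xyₗ , xy , tt)) ,
     Distinct-↭ (map⁺ proj₁ P↭) (map⁺ proj₂ P↭) (Distinct-∷ x∉ y∉ d)) ,
    sym (↭-length P↭)
    where
    P = (x₀ , y₀) ∷ ps
    P↭ : (x , y) ∷ P ↭ P ++ [ (x , y) ]
    P↭ = ∷↭∷ʳ (x , y) P

  Path-reverse : Path ((x₀ , y₀) ∷ ps) → x ∉ Xs ((x₀ , y₀) ∷ ps) → Edge x (end y₀ ps) →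
                 Path ((x , end y₀ ps) ∷ reverseWalk y₀ ps) ×
                 Ys ((x₀ , y₀) ∷ ps) ↭ Ys ((x , end y₀ ps) ∷ reverseWalk y₀ ps)
  Path-reverse {x₀} {y₀} {ps} {x} ((_ , w) , (_ ∷ xs! , ys!)) x∉ xyₗ =
    ((xyₗ , Walk-reverse ps w) ,
     Unique-resp-↭ (↭-sym (prep x (Xs-reverseWalk y₀ ps))) (¬Any⇒All¬ _ (x∉ ∘ there) ∷ xs!) ,
     Unique-resp-↭ Ys↭ ys!) ,
    Ys↭
    where
    Ys↭ = ↭-sym (Ys-reverseWalk y₀ ps)

  -- Pósa rotation: the cycle x ⋯ y₀ x₀ y ⋯ yₗ x, whose first stretch reverses the path up to x.
  Path-close-at : ∀ M B → Path ((x₀ , y₀) ∷ M ++ (x , y) ∷ B) →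
                  Edge x (end y₀ (M ++ (x , y) ∷ B)) → Edge x₀ y →
                  HasCycle (suc (length (M ++ (x , y) ∷ B)))
  Path-close-at {x₀} {y₀} {x} {y} M B ((x₀y₀ , w) , d) xyₗ x₀y with Walk-++⁻ M w
  ... | wM , xyₘ , _ , wB =
    C , ((end y₀ (M ++ (x , y) ∷ B) , walk , returns) , Distinct-↭ Xs↭ Ys↭ d) ,
    sym (length-map-↭ proj₁ {P} {C} Xs↭)
    where
    P = (x₀ , y₀) ∷ M ++ (x , y) ∷ B
    C = (x , end y₀ M) ∷ reverseWalk y₀ M ++ (x₀ , y) ∷ B
    walk : Walk (end y₀ (M ++ (x , y) ∷ B)) C
    walk = xyₗ , xyₘ , Walk-++⁺ (reverseWalk y₀ M) (Walk-reverse M wM)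
             (subst (λ z → Walk z ((x₀ , y) ∷ B)) (sym (end-reverseWalk y₀ M)) (x₀y₀ , x₀y , wB))
    returns : end (end y₀ (M ++ (x , y) ∷ B)) C ≡ end y₀ (M ++ (x , y) ∷ B)
    returns = trans (end-++ (end y₀ M) (reverseWalk y₀ M) _) (sym (end-++ y₀ M _))
    Xs↭ : Xs P ↭ Xs C
    Xs↭ = ↭-sym (begin
      x ∷ Xs (reverseWalk y₀ M ++ (x₀ , y) ∷ B) ≡⟨ cong (x ∷_) (map-++ proj₁ (reverseWalk y₀ M) _) ⟩
      x ∷ Xs (reverseWalk y₀ M) ++ x₀ ∷ Xs B    ↭⟨ prep x (++⁺ʳ _ (Xs-reverseWalk y₀ M)) ⟩
      x ∷ Xs M ++ x₀ ∷ Xs B                     ↭⟨ prep x (shift x₀ (Xs M) (Xs B)) ⟩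
      x ∷ x₀ ∷ Xs M ++ Xs B                     ↭⟨ swap x x₀ ↭-refl ⟩
      x₀ ∷ x ∷ Xs M ++ Xs B                     ↭⟨ prep x₀ (↭-sym (shift x (Xs M) (Xs B))) ⟩
      x₀ ∷ Xs M ++ x ∷ Xs B                     ≡⟨ cong (x₀ ∷_) (map-++ proj₁ M _) ⟨
      Xs P                                      ∎)
      where open PermutationReasoning
    Ys↭ : Ys P ↭ Ys C
    Ys↭ = ↭-sym (begin
      end y₀ M ∷ Ys (reverseWalk y₀ M ++ (x₀ , y) ∷ B) ≡⟨ cong (_ ∷_) (map-++ proj₂ (reverseWalk y₀ M) _) ⟩
      (end y₀ M ∷ Ys (reverseWalk y₀ M)) ++ y ∷ Ys B   ↭⟨ ++⁺ʳ _ (Ys-reverseWalk y₀ M) ⟩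
      (y₀ ∷ Ys M) ++ y ∷ Ys B                          ≡⟨ cong (y₀ ∷_) (map-++ proj₂ M _) ⟨
      Ys P                                             ∎)
      where open PermutationReasoning

  Path-close : Path ((x₀ , y₀) ∷ ps) → endMisses x₀ y₀ ps < suc (length ps) → HasCycle (suc (length ps))
  Path-close {x₀} {y₀} {ps} path@((x₀y₀ , w) , d) few
    with count-∁-+-count-∁<length⇒Any (λ x → T? (G x (end y₀ ps))) (T? ∘ G x₀) ((x₀ , y₀) ∷ ps) few
  ... | here (x₀yₗ , _) = _ , ((end y₀ ps , (x₀yₗ , x₀y₀ , w) , refl) , d) , refl
  ... | there crossing with Any-∃++ crossing
  ...   | M , (x , y) , B , refl , (xyₗ , x₀y) = Path-close-at M B path xyₗ x₀y

  Cycle-open-edge : Cycle cs → x ∉ Xs cs → y ∉ Ys cs → Edge x y →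
                    misses G x (Ys cs) < length cs → HasPath (suc (length cs))
  Cycle-open-edge {cs} {x} {y} ((m , closed) , d) x∉ y∉ xy few
    with Any-∃++ (Any.map⁻ (count-∁<length⇒Any (T? ∘ G x) (Ys cs)
                              (subst (misses G x (Ys cs) <_) (sym (length-map proj₂ cs)) few)))
  ... | A , (x′ , y′) , B , refl , xy′ =
    N , (Walk⇒Chain walk , Distinct-↭ (map⁺ proj₁ N↭) (map⁺ proj₂ N↭) (Distinct-∷ x∉ y∉ d)) ,
    sym (↭-length N↭)
    where
    D = B ++ A ++ [ (x′ , y′) ]
    rotated : Closed y′ D
    rotated = subst (λ z → Closed z D) (end-++ m A _)
                (Closed-rotate (A ++ [ (x′ , y′) ]) (subst (Closed m) (sym (++-assoc A _ B)) closed))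
    N = D ++ [ (x , y) ]
    walk : Walk y′ N
    walk = Walk-++⁺ D (proj₁ rotated) (subst (λ z → Walk z [ (x , y) ]) (sym (proj₂ rotated)) (xy′ , xy , tt))
    N↭ : (x , y) ∷ A ++ (x′ , y′) ∷ B ↭ N
    N↭ = begin
      (x , y) ∷ A ++ (x′ , y′) ∷ B          ≡⟨ cong ((x , y) ∷_) (++-assoc A _ B) ⟨
      (x , y) ∷ (A ++ [ (x′ , y′) ]) ++ B   ↭⟨ prep (x , y) (++-comm (A ++ _) B) ⟩
      (x , y) ∷ D                           ↭⟨ ∷↭∷ʳ (x , y) D ⟩
      N                                     ∎
      where open PermutationReasoning

  -- Cut the cycle in front of a pair (x′ , y′) with x′ ∼ y and x ∼ y′: the path x y′ ⋯ x′ y.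
  Cycle-open-pair : Cycle cs → x ∉ Xs cs → y ∉ Ys cs →
                    misses (G ᵀ) y (Xs cs) + misses G x (Ys cs) < length cs → HasPath (suc (length cs))
  Cycle-open-pair {cs} {x} {y} ((m , closed) , d) x∉ y∉ few
    with Any-∃++ (count-∁-+-count-∁<length⇒Any (λ x′ → T? (G x′ y)) (T? ∘ G x) cs few)
  ... | A , (x′ , y′) , B , refl , (x′y , xy′) with Closed-rotate A closed
  ...   | (x′m , _ , wD) , returns =
    N , (chain , Distinct-↭ Xs↭ Ys↭ (Distinct-∷ x∉ y∉ d)) ,
    sym (length-map-↭ proj₁ {(x , y) ∷ A ++ (x′ , y′) ∷ B} {N} Xs↭)
    where
    D = B ++ A
    N = (x , y′) ∷ D ++ [ (x′ , y) ]
    chain : Chain N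
    chain = xy′ , Walk-++⁺ D wD (subst (λ z → Walk z [ (x′ , y) ]) (sym returns) (x′m , x′y , tt))
    cs↭ : A ++ (x′ , y′) ∷ B ↭ (x′ , y′) ∷ D
    cs↭ = ++-comm A ((x′ , y′) ∷ B)
    Xs↭ : x ∷ Xs (A ++ (x′ , y′) ∷ B) ↭ Xs N
    Xs↭ = begin
      x ∷ Xs (A ++ (x′ , y′) ∷ B)  ↭⟨ prep x (map⁺ proj₁ cs↭) ⟩
      x ∷ x′ ∷ Xs D                ↭⟨ prep x (∷↭∷ʳ x′ (Xs D)) ⟩
      x ∷ Xs D ++ [ x′ ]           ≡⟨ cong (x ∷_) (map-++ proj₁ D _) ⟨
      Xs N                         ∎
      where open PermutationReasoning
    Ys↭ : y ∷ Ys (A ++ (x′ , y′) ∷ B) ↭ Ys N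
    Ys↭ = begin
      y ∷ Ys (A ++ (x′ , y′) ∷ B)  ↭⟨ prep y (map⁺ proj₂ cs↭) ⟩
      y ∷ y′ ∷ Ys D                ↭⟨ swap y y′ ↭-refl ⟩
      y′ ∷ y ∷ Ys D                ↭⟨ prep y′ (∷↭∷ʳ y (Ys D)) ⟩
      y′ ∷ Ys D ++ [ y ]           ≡⟨ cong (y′ ∷_) (map-++ proj₂ D _) ⟨
      Ys N                         ∎
      where open PermutationReasoning

  Chain-edge : Chain ps → ∀ i → Edge (proj₁ (lookup ps i)) (proj₂ (lookup ps i))
  Chain-edge {_ ∷ _} (xy , _) zero = xy
  Chain-edge {_ ∷ _} (_ , w) (suc i) = Chain-edge (Walk⇒Chain w) i

  Chain-link : Chain (p ∷ ps) → ∀ j → Edge (proj₁ (lookup ps j)) (proj₂ (lookup (p ∷ ps) (inject₁ j)))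
  Chain-link {ps = _ ∷ _} (_ , x′y , _) zero = x′y
  Chain-link {ps = _ ∷ _} (_ , _ , x′y′ , w) (suc j) = Chain-link (x′y′ , w) j

  lookup-last : ∀ p ps → proj₂ (lookup (p ∷ ps) (fromℕ (length ps))) ≡ end (proj₂ p) ps
  lookup-last p [] = refl
  lookup-last p (p′ ∷ ps) = lookup-last p′ ps

  Cycle⇒BipCycle : Cycle (p ∷ ps) → BipCycle G (length ps)
  Cycle⇒BipCycle {x₀ , y₀} {ps} ((y , (x₀y , chain) , returns) , xs! , ys!) = record
    { xs = proj₁ ∘ lookup ((x₀ , y₀) ∷ ps)
    ; ys = proj₂ ∘ lookup ((x₀ , y₀) ∷ ps)
    ; xs-inj = map-lookup-injective proj₁ xs!
    ; ys-inj = map-lookup-injective proj₂ ys!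
    ; edge₁ = Chain-edge chain
    ; edge₂ = Chain-link chain
    ; close = subst (Edge x₀) (sym (trans (lookup-last (x₀ , y₀) ps) returns)) x₀y
    }

  length-reverseWalk : ∀ y ps → length (reverseWalk y ps) ≡ length ps
  length-reverseWalk y ps = length-map-↭ proj₁ {reverseWalk y ps} {ps} (Xs-reverseWalk y ps)

  HasCycle⇒HasCycleOn : ∀ n → 1 ≤ n → HasCycle (suc n) → HasCycleOn G (2 * suc n)
  HasCycle⇒HasCycleOn n 1≤n (_ ∷ _ , cycle , refl) = n , refl , 1≤n , Cycle⇒BipCycle cycle

module _ {s c p : ℕ} where

  saturated⇒< : ∀ {n} → s + n ≤ p + c → c + c < n → c < p
  saturated⇒< {n} sat 2c<n = +-cancelʳ-< c c p (<-≤-trans 2c<n (≤-trans (m≤n+m n s) sat))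

  saturated+bounded⇒< : ∀ {m n} → s + n ≤ p + c → m ≤ c → c + c < n → s + m < p
  saturated+bounded⇒< {m} {n} sat m≤c 2c<n = +-cancelʳ-< n (s + m) p (begin-strict
    s + m + n    ≡⟨ xy∙z≈xz∙y s m n ⟩
    s + n + m    ≤⟨ +-mono-≤ sat m≤c ⟩
    p + c + c    ≡⟨ +-assoc p c c ⟩
    p + (c + c)  <⟨ +-monoʳ-< p 2c<n ⟩
    p + n        ∎)
    where open ≤-Reasoning

  two-saturated⇒< : ∀ {t a b} → s + a ≤ p + c → t + b ≤ p + c → p < a → c + c < b → s + t < p
  two-saturated⇒< {t} {a} {b} sa tb p<a 2c<b = +-cancelʳ-< (a + b) (s + t) p (begin-strict
    s + t + (a + b)  ≡⟨ interchange s t a b ⟩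
    s + a + (t + b)  ≤⟨ +-mono-≤ sa tb ⟩
    p + c + (p + c)  ≡⟨ interchange p c p c ⟩
    p + p + (c + c)  <⟨ +-mono-< (+-monoʳ-< p p<a) 2c<b ⟩
    p + a + b        ≡⟨ +-assoc p a b ⟩
    p + (a + b)      ∎)
    where open ≤-Reasoning

module Construction {a b c k : ℕ} {G : BipGraph a b} (ac : AlmostComplete c G)
                    (2c<k : c + c < k) (k≤a : k ≤ a) (k≤b : k ≤ b) where

  open Walks G

  private variable
    x₀ : Fin a
    y₀ : Fin b
    ps cs : List (Fin a × Fin b)

  acᵀ : AlmostComplete c (G ᵀ)
  acᵀ = AlmostComplete-ᵀ {c = c} ac

  2c<a : c + c < a
  2c<a = <-≤-trans 2c<k k≤a

  2c<b : c + c < b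
  2c<b = <-≤-trans 2c<k k≤b

  fresh-x : length ps < k → ∃ λ x → x ∉ Xs ps
  fresh-x {ps} p<k = ∃∉ (Xs ps) (subst (_< a) (sym (length-map proj₁ ps)) (<-≤-trans p<k k≤a))

  fresh-y : length ps < k → ∃ λ y → y ∉ Ys ps
  fresh-y {ps} p<k = ∃∉ (Ys ps) (subst (_< b) (sym (length-map proj₂ ps)) (<-≤-trans p<k k≤b))

  boundedˣ : ∀ ps x → Distinct ps → misses G x (Ys ps) ≤ c
  boundedˣ ps x (_ , ys!) = misses-Unique≤ {c = c} ac x ys!

  boundedʸ : ∀ ps y → Distinct ps → misses (G ᵀ) y (Xs ps) ≤ c
  boundedʸ ps y (xs! , _) = misses-Unique≤ {c = c} acᵀ y xs!

  saturatedˣ : ∀ ps x → (∀ y → Edge x y → y ∈ Ys ps) → misses G x (Ys ps) + b ≤ length ps + c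
  saturatedˣ ps x N⊆ = subst (λ n → misses G x (Ys ps) + b ≤ n + c) (length-map proj₂ ps)
                           (misses-⊇-neighbours {c = c} ac x (Ys ps) N⊆)

  saturatedʸ : ∀ ps y → (∀ x → Edge x y → x ∈ Xs ps) → misses (G ᵀ) y (Xs ps) + a ≤ length ps + c
  saturatedʸ ps y N⊆ = subst (λ n → misses (G ᵀ) y (Xs ps) + a ≤ n + c) (length-map proj₁ ps)
                           (misses-⊇-neighbours {c = c} acᵀ y (Xs ps) N⊆)

  extend-Cycle : Cycle cs → c < length cs → length cs < k → HasPath (suc (length cs))
  extend-Cycle {cs} cycle@(_ , d) c<p p<k with fresh-x {cs} p<k
  ... | x , x∉ with ∃∉-or-⊆ (T? ∘ G x) (Ys cs)
  ...   | inj₁ (y , y∉ , xy) = Cycle-open-edge cycle x∉ y∉ xy (≤-<-trans (boundedˣ cs x d) c<p)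
  ...   | inj₂ Nx⊆ with fresh-y {cs} p<k
  ...     | y , y∉ with ∃∉-or-⊆ (λ x′ → T? (G x′ y)) (Xs cs)
  ...       | inj₁ (x′ , x′∉ , x′y) = Cycle-open-edge cycle x′∉ y∉ x′y (≤-<-trans (boundedˣ cs x′ d) c<p)
  ...       | inj₂ Ny⊆ = Cycle-open-pair cycle x∉ y∉
                           (two-saturated⇒< (saturatedʸ cs y Ny⊆) (saturatedˣ cs x Nx⊆) (<-≤-trans p<k k≤a) 2c<b)

  extend-Path-via-Cycle : Path ((x₀ , y₀) ∷ ps) → endMisses x₀ y₀ ps < suc (length ps) →
                          c < suc (length ps) → suc (length ps) < k → HasPath (2 + length ps)
  extend-Path-via-Cycle path few c<p p<k with Path-close path few
  ... | cs , cycle , len = subst (λ n → HasPath (suc n)) len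
                             (extend-Cycle cycle (subst (c <_) (sym len) c<p) (subst (_< k) (sym len) p<k))

  extend-Path : Path ((x₀ , y₀) ∷ ps) → suc (length ps) < k → HasPath (2 + length ps)
  extend-Path {x₀} {y₀} {ps} path@(_ , d) p<k
    with ∃∉-or-⊆ (λ x → T? (G x (end y₀ ps))) (Xs ((x₀ , y₀) ∷ ps))
  ... | inj₂ Nyₗ⊆ =
    extend-Path-via-Cycle path (saturated+bounded⇒< sat (boundedˣ P x₀ d) 2c<a) (saturated⇒< sat 2c<a) p<k
    where
    P = (x₀ , y₀) ∷ ps
    sat = saturatedʸ P (end y₀ ps) Nyₗ⊆
  ... | inj₁ (x , x∉ , xyₗ) with ∃∉-or-⊆ (T? ∘ G x) (Ys ((x₀ , y₀) ∷ ps))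
  ...   | inj₁ (y , y∉ , xy) = Path-snoc path x∉ y∉ xyₗ xy
  ...   | inj₂ Nx⊆ with Path-reverse path x∉ xyₗ
  ...     | reversed@(_ , d′) , Ys↭ =
    subst (λ n → HasPath (2 + n)) (length-reverseWalk y₀ ps)
      (extend-Path-via-Cycle reversed few (saturated⇒< sat 2c<b)
         (subst (λ n → suc n < k) (sym (length-reverseWalk y₀ ps)) p<k))
    where
    Q = (x , end y₀ ps) ∷ reverseWalk y₀ ps
    sat : misses G x (Ys Q) + b ≤ length Q + c
    sat = saturatedˣ Q x (λ y xy → ∈-resp-↭ Ys↭ (Nx⊆ y xy))
    few : endMisses x (end y₀ ps) (reverseWalk y₀ ps) < length Q
    few = subst (_< length Q) (+-comm (misses G x (Ys Q)) _) (saturated+bounded⇒< sat (boundedʸ Q _ d′) 2c<b)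

  one-edge-path : Fin a → HasPath 1
  one-edge-path x with satisfied (count-∁<length⇒Any (T? ∘ G x) (allFin b) few)
    where
    few = subst (misses G x (allFin b) <_) (sym (length-tabulate id))
            (≤-<-trans (misses-allFin≤ {c = c} ac x) (≤-<-trans (m≤m+n c c) 2c<b))
  ... | y , xy = [ (x , y) ] , ((xy , tt) , ([] ∷ [] , [] ∷ [])) , refl

  path-of-length : ∀ n → suc n ≤ k → HasPath (suc n)
  path-of-length zero 0<k = one-edge-path (fromℕ< (<-≤-trans 0<k k≤a))
  path-of-length (suc n) n<k with path-of-length n (<⇒≤ n<k)
  ... | (x₀ , y₀) ∷ ps , path , refl = extend-Path path n<k

  cycle-of-length : ∀ n → suc n ≡ k → HasCycle (suc n)
  cycle-of-length n refl with path-of-length n ≤-refl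
  ... | P@((x₀ , y₀) ∷ ps) , path@(_ , d) , refl =
    Path-close path (≤-<-trans (+-mono-≤ (boundedʸ P (end y₀ ps) d) (boundedˣ P x₀ d)) 2c<k)

corollary6p5 : (a b c : ℕ) (G : BipGraph a b) → AlmostComplete c G →
    (k : ℕ) → 4 * c + 2 ≤ 2 * k → 2 * k ≤ 2 * (a ⊓ b) → 4 ≤ 2 * k →
    HasCycleOn G (2 * k)
corollary6p5 a b c G ac zero _ _ ()
corollary6p5 a b c G ac (suc n) 4c+2≤2k 2k≤2[a⊓b] 4≤2k =
  HasCycle⇒HasCycleOn n (s≤s⁻¹ (*-cancelˡ-≤ {2} 2 4≤2k)) (cycle-of-length n refl)
  where
  open Walks G
  4m+2≡2[1+2m] : ∀ m → 4 * m + 2 ≡ 2 * suc (m + m)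
  4m+2≡2[1+2m] = solve-∀
  2c<k : c + c < suc n
  2c<k = *-cancelˡ-≤ 2 (subst (_≤ 2 * suc n) (4m+2≡2[1+2m] c) 4c+2≤2k)
  k≤a⊓b : suc n ≤ a ⊓ b
  k≤a⊓b = *-cancelˡ-≤ 2 2k≤2[a⊓b]
  open Construction {c = c} ac 2c<k (≤-trans k≤a⊓b (m⊓n≤m a b)) (≤-trans k≤a⊓b (m⊓n≤n a b))
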